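{- If $k\ge 3$ and $t>1$, then \[ m^s_t(k,q)\le m^{s-1}(t,q)+k-t+1. \]
   Context: A linear $[n,k,d]_q$ code is identified with a projective system: a finite multiset $\mathcal{G}$ of $n$ points of $\mathrm{PG}(k-1,q)$, not all in one hyperplane, with $n-d=\max_H|\mathcal{G}\cap H|$ over hyperplanes $H$ (multiplicities counted); equivalently the columns of a generator matrix of a non-degenerate linear code $C\subseteq\mathbb{F}_q^n$. The Singleton defect is $n-k+1-d$; the code is A$^s$MDS if its defect is $s$. The dual code is $C^\perp$, of dimension $n-k$. $m^s(k,q)$ is the maximum length of a non-degenerate $[n,k,d]_q$ A$^s$MDS code, and $m^s_t(k,q)$ is the maximum length of a non-degenerate $[n,k,d]_q$ A$^s$MDS code whose dual code is A$^t$MDS. -}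

module Defs where

open import Data.Nat using (ℕ; zero; suc; _+_; _≤_)
open import Data.Fin using (Fin; _≟_) renaming (zero to fz; suc to fs)
open import Data.Product using (Σ; ∃; _×_)
open import Relation.Nullary using (¬_; yes; no)
open import Relation.Binary.PropositionalEquality using (_≡_; _≢_)
open import Algebra.Structures using (IsCommutativeRing)

record FiniteField (q : ℕ) : Set where
  field
    _+F_ _*F_ : Fin q → Fin q → Fin q
    -F_       : Fin q → Fin q
    0F 1F     : Fin q
    isCommutativeRing : IsCommutativeRing _≡_ _+F_ _*F_ -F_ 0F 1F
    0≢1       : 0F ≢ 1F
    inverse   : (x : Fin q) → x ≢ 0F → ∃ λ y → x *F y ≡ 1F

module _ {q : ℕ} (F : FiniteField q) where
  open FiniteField F

  Word : ℕ → Set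
  Word n = Fin n → Fin q

  ΣF : ∀ {n} → (Fin n → Fin q) → Fin q
  ΣF {zero}  f = 0F
  ΣF {suc n} f = f fz +F ΣF (λ i → f (fs i))

  wt : ∀ {n} → Word n → ℕ
  wt {zero}  v = 0
  wt {suc n} v with v fz ≟ 0F
  ... | yes _ = wt (λ i → v (fs i))
  ... | no  _ = suc (wt (λ i → v (fs i)))

  NonZero : ∀ {n} → Word n → Set
  NonZero {n} v = Σ (Fin n) λ j → v j ≢ 0F

  Matrix : ℕ → ℕ → Set
  Matrix k n = Fin k → Fin n → Fin q

  encode : ∀ {k n} → Matrix k n → Word k → Word n
  encode G x j = ΣF (λ i → x i *F G i j)

  InCode : ∀ {k n} → Matrix k n → Word n → Set
  InCode {k} G v = Σ (Word k) λ x → ∀ j → v j ≡ encode G x j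

  InDual : ∀ {k n} → Matrix k n → Word n → Set
  InDual {k} G v = ∀ (i : Fin k) → ΣF (λ j → G i j *F v j) ≡ 0F

  RowsIndep : ∀ {k n} → Matrix k n → Set
  RowsIndep {k} G = ∀ (x : Word k) → (∀ j → encode G x j ≡ 0F) → ∀ i → x i ≡ 0F

  NonDegenerate : ∀ {k n} → Matrix k n → Set
  NonDegenerate {k} {n} G = ∀ (j : Fin n) → Σ (Fin k) λ i → G i j ≢ 0F

  MinDist : ∀ {n} → (Word n → Set) → ℕ → Set
  MinDist {n} P d =
    (Σ (Word n) λ v → P v × NonZero v × wt v ≡ d) ×
    (∀ (v : Word n) → P v → NonZero v → d ≤ wt v)

  -- G generates a non-degenerate [n,k,d]_q code which is A^s MDS (n - k + 1 - d = s)
  IsAsMDS : ∀ {k n} → Matrix k n → ℕ → Set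
  IsAsMDS {k} {n} G s =
    RowsIndep G × NonDegenerate G ×
    (∃ λ d → MinDist (InCode G) d × n + 1 ≡ k + d + s)

  -- the dual code (an [n, n-k, d⊥] code) is A^t MDS: n - (n-k) + 1 - d⊥ = t
  DualIsAtMDS : ∀ {k n} → Matrix k n → ℕ → Set
  DualIsAtMDS {k} {n} G t =
    ∃ λ d⊥ → MinDist (InDual G) d⊥ × k + 1 ≡ d⊥ + t

{-# OPTIONS --safe #-}
module Submission where

-- Let v be a dual codeword of minimum weight w = k + 1 − t. Orthogonality to v is a linear
-- relation among the coordinates in its support, so codewords vanishing on w − 1 of them vanish
-- on all of them: these codewords form a subcode of dimension at least t. Taking t independent
-- ones and deleting the coordinates where all of them vanish leaves an [N, t, ≥ d] code with
-- N ≤ n − w, that is, of defect at most s − 1. Prepending copies of one column then adds one to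
-- the length at a time, while the minimum distance never decreases and stays bounded (a message
-- orthogonal to the repeated column does not see it); so at some length n′ ≥ n − w the defect
-- is exactly s − 1, and n′ ≥ n − k − 1 + t is the claimed bound.

open import Defs
open import Data.Nat using (ℕ; zero; suc; _+_; _∸_; _≤_; _<_; z≤n; s≤s)
open import Data.Product using (Σ; ∃; ∃₂; _×_; _,_; proj₁; proj₂)

import Data.Nat.Properties as ℕ
open import Data.Fin as Fin using (Fin; _≟_) renaming (zero to fz; suc to fs)
open import Data.Fin.Properties using (punchInᵢ≢i; all?; ¬∀⟶∃¬)
open import Data.Vec.Functional using () renaming (_∷_ to _∷ᵥ_)
open import Data.Sum using (_⊎_; inj₁; inj₂)
open import Data.List using (List; []; _∷_; length; map; _++_; tabulate; allFin)
open import Data.List.Membership.Propositional using (_∈_)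
open import Data.List.Membership.Propositional.Properties using (∈-map⁺; ∈-allFin)
open import Data.List.Relation.Unary.Any using (here; there)
open import Data.List.Extrema.Nat using (argmin; f[argmin]≤f[xs])
open import Data.List.Properties using (length-map; length-++; length-tabulate)
open import Data.List.Relation.Unary.All as All using (All)
open import Data.List.Relation.Unary.All.Properties using (map⁻; ++⁻ˡ; ++⁻ʳ; tabulate⁻)
open import Data.List.Relation.Binary.Permutation.Propositional
  using (_↭_; ↭-refl; ↭-prep; ↭-swap; ↭-trans; ↭-sym)
open import Data.List.Relation.Binary.Permutation.Propositional.Properties using (All-resp-↭; ↭-length)
open import Function using (_∘_)
open import Relation.Nullary using (yes; no; contradiction)
open import Relation.Binary.PropositionalEquality
open import Algebra.Bundles using (CommutativeRing)
import Algebra.Properties.Ring as RingProperties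
import Algebra.Properties.Semiring.Sum as SemiringSum
import Algebra.Properties.CommutativeSemigroup as CommutativeSemigroupProperties
open import Level using (0ℓ)
open import Data.Nat.Tactic.RingSolver using (solve)

catchUp : (f g : ℕ → ℕ) {b : ℕ} → (∀ m → f (suc m) ≡ suc (f m)) → (∀ m → g m ≤ g (suc m)) →
          (∀ m → g m ≤ b) → ∀ m → f m ≤ g m → ∃ λ m′ → m ≤ m′ × f m′ ≡ g m′
catchUp f g {b} f-step g-mono g≤b m fm≤gm = go (suc b) m (s≤s (ℕ.m≤m+n b (f m))) fm≤gm
  where
  go : ∀ fuel m → b < fuel + f m → f m ≤ g m → ∃ λ m′ → m ≤ m′ × f m′ ≡ g m′
  go zero m b<fm fm≤gm = contradiction (ℕ.≤-trans fm≤gm (g≤b m)) (ℕ.<⇒≱ b<fm)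
  go (suc fuel) m b<1+fuel+fm fm≤gm with f m ℕ.≟ g m
  ... | yes fm≡gm = m , ℕ.≤-refl , fm≡gm
  ... | no fm≢gm with go fuel (suc m) b<fuel+f[1+m] f[1+m]≤g[1+m]
    where
    b<fuel+f[1+m] : b < fuel + f (suc m)
    b<fuel+f[1+m] = subst (b <_) (trans (sym (ℕ.+-suc fuel (f m))) (cong (fuel +_) (sym (f-step m))))
                          b<1+fuel+fm
    f[1+m]≤g[1+m] : f (suc m) ≤ g (suc m)
    f[1+m]≤g[1+m] = subst (_≤ g (suc m)) (sym (f-step m)) (ℕ.≤-trans (ℕ.≤∧≢⇒< fm≤gm fm≢gm) (g-mono m))
  ...   | m′ , 1+m≤m′ , fm′≡gm′ = m′ , ℕ.≤-trans (ℕ.n≤1+n m) 1+m≤m′ , fm′≡gm′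

-- The weight of the zero word is replaced by b, above every genuine weight, so that a
-- minimiser over all messages is a nonzero codeword of minimum weight.
nonzeroOr : ℕ → ℕ → ℕ
nonzeroOr b zero    = b
nonzeroOr b (suc w) = suc w

nonzeroOr-pos : ∀ b {w} → 0 < w → nonzeroOr b w ≡ w
nonzeroOr-pos b {suc w} _ = refl

module _ {q : ℕ} (F : FiniteField q) where

  open FiniteField F using (0F; 1F; 0≢1; inverse; isCommutativeRing)
    renaming (_+F_ to infixl 6 _+F_; _*F_ to infixl 7 _*F_; -F_ to infix 8 -F_)

  commutativeRing : CommutativeRing 0ℓ 0ℓ
  commutativeRing = record { isCommutativeRing = isCommutativeRing }

  open CommutativeRing commutativeRing
    using ( +-comm; +-identityˡ; +-identityʳ; -‿inverseʳ
          ; *-assoc; *-comm; *-identityʳ; zeroˡ; zeroʳ; distribˡ; distribʳ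
          ; ring; semiring; *-commutativeSemigroup)
  open RingProperties ring using (-‿distribˡ-*)
  open CommutativeSemigroupProperties *-commutativeSemigroup using (x∙yz≈y∙xz)
  private module Sum = SemiringSum semiring

  x*y≡0⇒x≡0 : ∀ {x y} → y ≢ 0F → x *F y ≡ 0F → x ≡ 0F
  x*y≡0⇒x≡0 {x} {y} y≢0 xy≡0 with inverse y y≢0
  ... | y⁻¹ , yy⁻¹≡1 = begin
    x                ≡⟨ sym (*-identityʳ x) ⟩
    x *F 1F          ≡⟨ cong (x *F_) yy⁻¹≡1 ⟨
    x *F (y *F y⁻¹)  ≡⟨ *-assoc x y y⁻¹ ⟨
    x *F y *F y⁻¹    ≡⟨ cong (_*F y⁻¹) xy≡0 ⟩
    0F *F y⁻¹        ≡⟨ zeroˡ y⁻¹ ⟩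
    0F               ∎
    where open ≡-Reasoning

  *-nonzero : ∀ {x y} → x ≢ 0F → y ≢ 0F → x *F y ≢ 0F
  *-nonzero x≢0 y≢0 = x≢0 ∘ x*y≡0⇒x≡0 y≢0

  ΣF≡sum : ∀ {n} (f : Fin n → Fin q) → ΣF F f ≡ Sum.sum f
  ΣF≡sum {zero}  f = refl
  ΣF≡sum {suc n} f = cong (f fz +F_) (ΣF≡sum (f ∘ fs))

  ΣF-cong : ∀ {n} {f g : Fin n → Fin q} → f ≗ g → ΣF F f ≡ ΣF F g
  ΣF-cong {f = f} {g} f≗g = trans (ΣF≡sum f) (trans (Sum.sum-cong-≗ f≗g) (sym (ΣF≡sum g)))

  ΣF-zero : ∀ {n} {f : Fin n → Fin q} → (∀ i → f i ≡ 0F) → ΣF F f ≡ 0F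
  ΣF-zero {n} {f} f≡0 = trans (ΣF≡sum f) (trans (Sum.sum-cong-≗ f≡0) (Sum.sum-replicate-zero n))

  ΣF-+ : ∀ {n} (f g : Fin n → Fin q) → ΣF F (λ i → f i +F g i) ≡ ΣF F f +F ΣF F g
  ΣF-+ f g = trans (ΣF≡sum (λ i → f i +F g i))
                   (trans (Sum.∑-distrib-+ f g) (sym (cong₂ _+F_ (ΣF≡sum f) (ΣF≡sum g))))

  ΣF-*ˡ : ∀ {n} (x : Fin q) (f : Fin n → Fin q) → ΣF F (λ i → x *F f i) ≡ x *F ΣF F f
  ΣF-*ˡ x f = trans (ΣF≡sum (λ i → x *F f i))
                    (trans (sym (Sum.*-distribˡ-sum x f)) (sym (cong (x *F_) (ΣF≡sum f))))

  ΣF-*ʳ : ∀ {n} (x : Fin q) (f : Fin n → Fin q) → ΣF F (λ i → f i *F x) ≡ ΣF F f *F x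
  ΣF-*ʳ x f = trans (ΣF≡sum (λ i → f i *F x))
                    (trans (sym (Sum.*-distribʳ-sum x f)) (sym (cong (_*F x) (ΣF≡sum f))))

  ΣF-comm : ∀ {m n} (f : Fin m → Fin n → Fin q) →
            ΣF F (λ i → ΣF F (f i)) ≡ ΣF F (λ j → ΣF F (λ i → f i j))
  ΣF-comm f = trans (ΣΣF≡sum-sum f) (trans (Sum.∑-comm f) (sym (ΣΣF≡sum-sum (λ j i → f i j))))
    where
    ΣΣF≡sum-sum : ∀ {a b} (g : Fin a → Fin b → Fin q) →
                  ΣF F (λ i → ΣF F (g i)) ≡ Sum.sum (λ i → Sum.sum (g i))
    ΣΣF≡sum-sum g = trans (ΣF≡sum (λ i → ΣF F (g i))) (Sum.sum-cong-≗ (λ i → ΣF≡sum (g i)))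

  ΣF-single : ∀ {n} (f : Fin n → Fin q) (j : Fin n) → (∀ i → i ≢ j → f i ≡ 0F) → ΣF F f ≡ f j
  ΣF-single {suc n} f j f≡0 = begin
    ΣF F f                              ≡⟨ ΣF≡sum f ⟩
    Sum.sum f                           ≡⟨ Sum.sum-remove {i = j} f ⟩
    f j +F Sum.sum (f ∘ Fin.punchIn j)  ≡⟨ cong (f j +F_) (Sum.sum-cong-≗ (λ i → f≡0 _ (punchInᵢ≢i j i))) ⟩
    f j +F Sum.sum {n} (λ _ → 0F)       ≡⟨ cong (f j +F_) (Sum.sum-replicate-zero n) ⟩
    f j +F 0F                           ≡⟨ +-identityʳ (f j) ⟩
    f j                                 ∎
    where open ≡-Reasoning

  dot : ∀ {k} → Word F k → Word F k → Fin q
  dot r x = ΣF F (λ i → x i *F r i)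

  dot-comm : ∀ {k} (r x : Word F k) → dot r x ≡ dot x r
  dot-comm r x = ΣF-cong (λ i → *-comm (x i) (r i))

  dot-lincomb : ∀ {k} (a b : Fin q) (r s u : Word F k) →
                dot (λ i → a *F r i +F b *F s i) u ≡ a *F dot r u +F b *F dot s u
  dot-lincomb a b r s u = begin
    ΣF F (λ i → u i *F (a *F r i +F b *F s i))
      ≡⟨ ΣF-cong (λ i → trans (distribˡ (u i) _ _)
                              (cong₂ _+F_ (x∙yz≈y∙xz (u i) a (r i)) (x∙yz≈y∙xz (u i) b (s i)))) ⟩
    ΣF F (λ i → a *F (u i *F r i) +F b *F (u i *F s i))
      ≡⟨ ΣF-+ (λ i → a *F (u i *F r i)) (λ i → b *F (u i *F s i)) ⟩
    ΣF F (λ i → a *F (u i *F r i)) +F ΣF F (λ i → b *F (u i *F s i))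
      ≡⟨ cong₂ _+F_ (ΣF-*ˡ a (λ i → u i *F r i)) (ΣF-*ˡ b (λ i → u i *F s i)) ⟩
    a *F dot r u +F b *F dot s u
      ∎
    where open ≡-Reasoning

  [xA]z≡x[Az] : ∀ {m n} (x : Fin m → Fin q) (A : Fin m → Fin n → Fin q) (z : Fin n → Fin q) →
                ΣF F (λ j → ΣF F (λ i → x i *F A i j) *F z j) ≡
                ΣF F (λ i → x i *F ΣF F (λ j → A i j *F z j))
  [xA]z≡x[Az] x A z = begin
    ΣF F (λ j → ΣF F (λ i → x i *F A i j) *F z j)
      ≡⟨ ΣF-cong (λ j → sym (ΣF-*ʳ (z j) (λ i → x i *F A i j))) ⟩
    ΣF F (λ j → ΣF F (λ i → x i *F A i j *F z j))
      ≡⟨ sym (ΣF-comm (λ i j → x i *F A i j *F z j)) ⟩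
    ΣF F (λ i → ΣF F (λ j → x i *F A i j *F z j))
      ≡⟨ ΣF-cong (λ i → trans (ΣF-cong (λ j → *-assoc (x i) (A i j) (z j)))
                              (ΣF-*ˡ (x i) (λ j → A i j *F z j))) ⟩
    ΣF F (λ i → x i *F ΣF F (λ j → A i j *F z j))
      ∎
    where open ≡-Reasoning

  1≢0 : 1F ≢ 0F
  1≢0 = 0≢1 ∘ sym

  unit : ∀ {k} → Fin k → Word F k
  unit p i with i ≟ p
  ... | yes _ = 1F
  ... | no _  = 0F

  unit-on : ∀ {k} (p : Fin k) → unit p p ≡ 1F
  unit-on p with p ≟ p
  ... | yes _   = refl
  ... | no p≢p = contradiction refl p≢p

  unit-off : ∀ {k} {p i : Fin k} → i ≢ p → unit p i ≡ 0F
  unit-off {p = p} {i} i≢p with i ≟ p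
  ... | yes i≡p = contradiction i≡p i≢p
  ... | no _    = refl

  unit-nonzero : ∀ {k} (p : Fin k) → NonZero F (unit p)
  unit-nonzero p = p , subst (_≢ 0F) (sym (unit-on p)) 1≢0

  dot-unit : ∀ {k} (p : Fin k) (x : Word F k) → dot (unit p) x ≡ x p
  dot-unit p x = begin
    ΣF F (λ i → x i *F unit p i)
      ≡⟨ ΣF-single (λ i → x i *F unit p i) p
                   (λ i i≢p → trans (cong (x i *F_) (unit-off i≢p)) (zeroʳ (x i))) ⟩
    x p *F unit p p  ≡⟨ cong (x p *F_) (unit-on p) ⟩
    x p *F 1F        ≡⟨ *-identityʳ (x p) ⟩
    x p              ∎
    where open ≡-Reasoning

  Solves : ∀ {k} → List (Word F k) → Word F k → Set
  Solves rs x = All (λ r → dot r x ≡ 0F) rs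

  pivotRow : ∀ {k} (rs : List (Word F (suc k))) →
             All (λ r → r fz ≡ 0F) rs ⊎ ∃₂ λ r₀ rs′ → r₀ fz ≢ 0F × rs ↭ r₀ ∷ rs′
  pivotRow []       = inj₁ All.[]
  pivotRow (r ∷ rs) with r fz ≟ 0F
  ... | no r-head≢0 = inj₂ (r , rs , r-head≢0 , ↭-refl)
  ... | yes r-head≡0 with pivotRow rs
  ...   | inj₁ heads≡0 = inj₁ (r-head≡0 All.∷ heads≡0)
  ...   | inj₂ (r₀ , rs′ , pivot≢0 , rs↭) =
          inj₂ (r₀ , r ∷ rs′ , pivot≢0 , ↭-trans (↭-prep r rs↭) (↭-swap r r₀ ↭-refl))

  -- Elimination without division: the first coordinate of r is cancelled against the pivot row r₀.
  eliminate : ∀ {k} → Word F (suc k) → Word F (suc k) → Word F k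
  eliminate r₀ r i = r₀ fz *F r (fs i) +F -F r fz *F r₀ (fs i)

  extend : ∀ {k} → Word F (suc k) → Word F k → Word F (suc k)
  extend r₀ u = -F dot (λ i → r₀ (fs i)) u ∷ᵥ (λ i → r₀ fz *F u i)

  dot-extend : ∀ {k} (r₀ r : Word F (suc k)) (u : Word F k) →
               dot r (extend r₀ u) ≡ dot (eliminate r₀ r) u
  dot-extend r₀ r u = begin
    -F D *F r fz +F ΣF F (λ i → r₀ fz *F u i *F r (fs i))
      ≡⟨ cong₂ _+F_ -D*c≡-c*D (trans (ΣF-cong (λ i → *-assoc (r₀ fz) (u i) (r (fs i))))
                                     (ΣF-*ˡ (r₀ fz) (λ i → u i *F r (fs i)))) ⟩
    -F r fz *F D +F r₀ fz *F dot (λ i → r (fs i)) u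
      ≡⟨ +-comm (-F r fz *F D) _ ⟩
    r₀ fz *F dot (λ i → r (fs i)) u +F -F r fz *F D
      ≡⟨ sym (dot-lincomb (r₀ fz) (-F r fz) (λ i → r (fs i)) (λ i → r₀ (fs i)) u) ⟩
    dot (eliminate r₀ r) u
      ∎
    where
    open ≡-Reasoning
    D : Fin q
    D = dot (λ i → r₀ (fs i)) u
    -D*c≡-c*D : -F D *F r fz ≡ -F r fz *F D
    -D*c≡-c*D = trans (sym (-‿distribˡ-* D (r fz)))
                      (trans (cong -F_ (*-comm D (r fz))) (-‿distribˡ-* (r fz) D))

  dot-eliminate-pivot : ∀ {k} (r₀ : Word F (suc k)) (u : Word F k) → dot (eliminate r₀ r₀) u ≡ 0F
  dot-eliminate-pivot r₀ u = begin
    dot (eliminate r₀ r₀) u      ≡⟨ dot-lincomb (r₀ fz) (-F r₀ fz) r₀′ r₀′ u ⟩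
    r₀ fz *F D +F -F r₀ fz *F D  ≡⟨ sym (distribʳ D (r₀ fz) (-F r₀ fz)) ⟩
    (r₀ fz +F -F r₀ fz) *F D     ≡⟨ cong (_*F D) (-‿inverseʳ (r₀ fz)) ⟩
    0F *F D                      ≡⟨ zeroˡ D ⟩
    0F                           ∎
    where
    open ≡-Reasoning
    r₀′ : Word F _
    r₀′ i = r₀ (fs i)
    D : Fin q
    D = dot r₀′ u

  nontrivialSolution : ∀ k (rs : List (Word F k)) → length rs < k →
                       ∃ λ x → NonZero F x × Solves rs x
  nontrivialSolution zero    rs ()
  nontrivialSolution (suc k) rs |rs|<1+k with pivotRow rs
  ... | inj₁ heads≡0 =
    unit fz , unit-nonzero fz ,
    All.map (λ {r} r-head≡0 → trans (dot-comm r (unit fz)) (trans (dot-unit fz r) r-head≡0)) heads≡0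
  ... | inj₂ (r₀ , rs′ , pivot≢0 , rs↭) =
    extendSolution (nontrivialSolution k (map (eliminate r₀) rs′) |rs′|<k)
    where
    |rs′|<k : length (map (eliminate r₀) rs′) < k
    |rs′|<k = subst (_< k) (sym (length-map (eliminate r₀) rs′))
                     (ℕ.≤-pred (subst (_< suc k) (↭-length rs↭) |rs|<1+k))
    extendSolution : (∃ λ u → NonZero F u × Solves (map (eliminate r₀) rs′) u) →
                     ∃ λ x → NonZero F x × Solves rs x
    extendSolution (u , (j , uj≢0) , u-solves) =
      extend r₀ u , (fs j , *-nonzero pivot≢0 uj≢0) ,
      All-resp-↭ (↭-sym rs↭) (trans (dot-extend r₀ r₀ u) (dot-eliminate-pivot r₀ u) All.∷
                              All.map (λ {r} → trans (dot-extend r₀ r u)) (map⁻ u-solves))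

  record IsEchelon {i k} (X : Matrix F i k) (pivot : Fin i → Fin k) : Set where
    field
      pivot-nonzero        : ∀ a → X a (pivot a) ≢ 0F
      zero-at-later-pivots : ∀ {a b} → a Fin.< b → X a (pivot b) ≡ 0F

  echelon-independent : ∀ {i k} {X : Matrix F i k} {P : Fin i → Fin k} → IsEchelon X P →
                        ∀ y → (∀ b → encode F X y (P b) ≡ 0F) → ∀ a → y a ≡ 0F
  echelon-independent {suc i} {X = X} {P} ech y yX≡0 = y≡0
    where
    open IsEchelon ech
    open ≡-Reasoning

    tail-echelon : IsEchelon (λ a → X (fs a)) (λ a → P (fs a))
    tail-echelon = record
      { pivot-nonzero        = λ a → pivot-nonzero (fs a)
      ; zero-at-later-pivots = λ a<b → zero-at-later-pivots (s≤s a<b)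
      }

    tail-y≡0 : ∀ a → y (fs a) ≡ 0F
    tail-y≡0 = echelon-independent tail-echelon (λ a → y (fs a)) λ b → begin
      encode F (λ a → X (fs a)) (λ a → y (fs a)) (P (fs b))
        ≡⟨ +-identityˡ _ ⟨
      0F +F encode F (λ a → X (fs a)) (λ a → y (fs a)) (P (fs b))
        ≡⟨ cong (_+F encode F (λ a → X (fs a)) (λ a → y (fs a)) (P (fs b)))
                (trans (cong (y fz *F_) (zero-at-later-pivots (s≤s z≤n))) (zeroʳ (y fz))) ⟨
      encode F X y (P (fs b))
        ≡⟨ yX≡0 (fs b) ⟩
      0F
        ∎

    head-y≡0 : y fz ≡ 0F
    head-y≡0 = x*y≡0⇒x≡0 (pivot-nonzero fz) (begin
      y fz *F X fz (P fz)
        ≡⟨ +-identityʳ _ ⟨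
      y fz *F X fz (P fz) +F 0F
        ≡⟨ cong (_ +F_) (ΣF-zero (λ a → trans (cong (_*F _) (tail-y≡0 a)) (zeroˡ _))) ⟨
      encode F X y (P fz)
        ≡⟨ yX≡0 fz ⟩
      0F
        ∎)

    y≡0 : ∀ a → y a ≡ 0F
    y≡0 fz     = head-y≡0
    y≡0 (fs a) = tail-y≡0 a

  echelon⇒RowsIndep : ∀ {i k} {X : Matrix F i k} {P : Fin i → Fin k} →
                      IsEchelon X P → RowsIndep F X
  echelon⇒RowsIndep {P = P} ech y yX≡0 = echelon-independent ech y (yX≡0 ∘ P)

  echelonSolutions : ∀ {k} (cs : List (Word F k)) i → length cs + i ≤ k →
                     ∃₂ λ (X : Matrix F i k) P → IsEchelon X P × (∀ a → Solves cs (X a))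
  echelonSolutions cs zero _ =
    (λ ()) , (λ ()) , record { pivot-nonzero = λ () ; zero-at-later-pivots = λ { {()} } } , λ ()
  echelonSolutions {k} cs (suc i) |cs|+1+i≤k
    with echelonSolutions cs i (ℕ.≤-trans (ℕ.+-monoʳ-≤ (length cs) (ℕ.n≤1+n i)) |cs|+1+i≤k)
  ... | X , P , ech , X-solves with nontrivialSolution k (cs ++ tabulate (unit ∘ P)) |cs++pivots|<k
    where
    |cs++pivots|<k : length (cs ++ tabulate (unit ∘ P)) < k
    |cs++pivots|<k =
      subst (_< k) (sym (trans (length-++ cs) (cong (length cs +_) (length-tabulate (unit ∘ P)))))
                   (subst (_≤ k) (ℕ.+-suc (length cs) i) |cs|+1+i≤k)
  ...   | x , (p , xp≢0) , x-solves = x ∷ᵥ X , p ∷ᵥ P , echelon , solves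
    where
    open IsEchelon ech
    echelon : IsEchelon (x ∷ᵥ X) (p ∷ᵥ P)
    echelon = record { pivot-nonzero = nonzero ; zero-at-later-pivots = later }
      where
      nonzero : ∀ a → (x ∷ᵥ X) a ((p ∷ᵥ P) a) ≢ 0F
      nonzero fz     = xp≢0
      nonzero (fs a) = pivot-nonzero a
      later : ∀ {a b} → a Fin.< b → (x ∷ᵥ X) a ((p ∷ᵥ P) b) ≡ 0F
      later {fz}   {fs b} _         = trans (sym (dot-unit (P b) x)) (tabulate⁻ (++⁻ʳ cs x-solves) b)
      later {fs a} {fs b} (s≤s a<b) = zero-at-later-pivots a<b
    solves : ∀ a → Solves cs ((x ∷ᵥ X) a)
    solves fz     = ++⁻ˡ cs x-solves
    solves (fs a) = X-solves a

  wt₁ : Fin q → ℕ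
  wt₁ a with a ≟ 0F
  ... | yes _ = 0
  ... | no _  = 1

  wt₁-zero : ∀ {a} → a ≡ 0F → wt₁ a ≡ 0
  wt₁-zero {a} a≡0 with a ≟ 0F
  ... | yes _   = refl
  ... | no a≢0 = contradiction a≡0 a≢0

  wt₁≤1 : ∀ a → wt₁ a ≤ 1
  wt₁≤1 a with a ≟ 0F
  ... | yes _ = z≤n
  ... | no _  = s≤s z≤n

  wt-step : ∀ {n} (v : Word F (suc n)) → wt F v ≡ wt₁ (v fz) + wt F (λ i → v (fs i))
  wt-step v with v fz ≟ 0F
  ... | yes _ = refl
  ... | no _  = refl

  wt-cong : ∀ {n} {v w : Word F n} → v ≗ w → wt F v ≡ wt F w
  wt-cong {zero}          _   = refl
  wt-cong {suc n} {v} {w} v≗w = begin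
    wt F v                                   ≡⟨ wt-step v ⟩
    wt₁ (v fz) + wt F (λ i → v (fs i))       ≡⟨ cong₂ _+_ (cong wt₁ (v≗w fz)) (wt-cong (v≗w ∘ fs)) ⟩
    wt₁ (w fz) + wt F (λ i → w (fs i))       ≡⟨ wt-step w ⟨
    wt F w                                   ∎
    where open ≡-Reasoning

  wt≤length : ∀ {n} (v : Word F n) → wt F v ≤ n
  wt≤length {zero}  v = z≤n
  wt≤length {suc n} v with v fz ≟ 0F
  ... | yes _ = ℕ.m≤n⇒m≤1+n (wt≤length (v ∘ fs))
  ... | no _  = s≤s (wt≤length (v ∘ fs))

  wt≡0⇒zero : ∀ {n} (v : Word F n) → wt F v ≡ 0 → ∀ j → v j ≡ 0F
  wt≡0⇒zero {suc n} v wt≡0 j with v fz ≟ 0F | j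
  ... | yes v₀≡0 | fz    = v₀≡0
  ... | yes _    | fs j′ = wt≡0⇒zero (v ∘ fs) wt≡0 j′
  ... | no _     | _     = contradiction wt≡0 ℕ.1+n≢0

  zero⇒wt≡0 : ∀ {n} (v : Word F n) → (∀ j → v j ≡ 0F) → wt F v ≡ 0
  zero⇒wt≡0 {zero}  v _   = refl
  zero⇒wt≡0 {suc n} v v≡0 with v fz ≟ 0F
  ... | yes _    = zero⇒wt≡0 (v ∘ fs) (v≡0 ∘ fs)
  ... | no v₀≢0 = contradiction (v≡0 fz) v₀≢0

  NonZero⇒wt>0 : ∀ {n} (v : Word F n) → NonZero F v → 0 < wt F v
  NonZero⇒wt>0 {suc n} v (j , vj≢0) with v fz ≟ 0F | j
  ... | no _     | _     = s≤s z≤n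
  ... | yes v₀≡0 | fz    = contradiction v₀≡0 vj≢0
  ... | yes _    | fs j′ = NonZero⇒wt>0 (v ∘ fs) (j′ , vj≢0)

  wt>0⇒NonZero : ∀ {n} (v : Word F n) → 0 < wt F v → NonZero F v
  wt>0⇒NonZero {suc n} v wt>0 with v fz ≟ 0F
  ... | no v₀≢0 = fz , v₀≢0
  ... | yes _ with wt>0⇒NonZero (v ∘ fs) wt>0
  ...   | j , vj≢0 = fs j , vj≢0

  zero⊎NonZero : ∀ {n} (v : Word F n) → (∀ j → v j ≡ 0F) ⊎ NonZero F v
  zero⊎NonZero v with wt F v in wt≡
  ... | zero  = inj₁ (wt≡0⇒zero v wt≡)
  ... | suc _ = inj₂ (wt>0⇒NonZero v (subst (0 <_) (sym wt≡) (s≤s z≤n)))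

  NonZero-cong : ∀ {n} {v w : Word F n} → v ≗ w → NonZero F v → NonZero F w
  NonZero-cong v≗w (j , vj≢0) = j , vj≢0 ∘ trans (v≗w j)

  encode-cong : ∀ {t N} (M : Matrix F t N) {y y′ : Word F t} →
                y ≗ y′ → encode F M y ≗ encode F M y′
  encode-cong M y≗y′ j = ΣF-cong (λ i → cong (_*F M i j) (y≗y′ i))

  encode-zero : ∀ {t N} (M : Matrix F t N) {y : Word F t} →
                (∀ i → y i ≡ 0F) → ∀ j → encode F M y j ≡ 0F
  encode-zero M y≡0 j = ΣF-zero (λ i → trans (cong (_*F M i j) (y≡0 i)) (zeroˡ (M i j)))

  NonZero-encode⇒NonZero : ∀ {t N} (M : Matrix F t N) y → NonZero F (encode F M y) → NonZero F y
  NonZero-encode⇒NonZero M y (j , yMj≢0) with zero⊎NonZero y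
  ... | inj₁ y≡0   = contradiction (encode-zero M y≡0 j) yMj≢0
  ... | inj₂ y≢0 = y≢0

  RowsIndep⇒NonZero-encode : ∀ {t N} {M : Matrix F t N} → RowsIndep F M →
                             ∀ {y} → NonZero F y → NonZero F (encode F M y)
  RowsIndep⇒NonZero-encode {M = M} indep {y} (i , yi≢0) with zero⊎NonZero (encode F M y)
  ... | inj₁ yM≡0  = contradiction (indep y yM≡0 i) yi≢0
  ... | inj₂ yM≢0 = yM≢0

  support : ∀ {n} → Word F n → List (Fin n)
  support {zero}  v = []
  support {suc n} v with v fz ≟ 0F
  ... | yes _ = map fs (support (v ∘ fs))
  ... | no _  = fz ∷ map fs (support (v ∘ fs))

  length-support : ∀ {n} (v : Word F n) → length (support v) ≡ wt F v
  length-support {zero}  v = refl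
  length-support {suc n} v with v fz ≟ 0F
  ... | yes _ = trans (length-map fs (support (v ∘ fs))) (length-support (v ∘ fs))
  ... | no _  = cong suc (trans (length-map fs (support (v ∘ fs))) (length-support (v ∘ fs)))

  ∈-support⁺ : ∀ {n} (v : Word F n) {j} → v j ≢ 0F → j ∈ support v
  ∈-support⁺ {suc n} v {j} vj≢0 with v fz ≟ 0F | j
  ... | yes v₀≡0 | fz    = contradiction v₀≡0 vj≢0
  ... | yes _    | fs j′ = ∈-map⁺ fs (∈-support⁺ (v ∘ fs) vj≢0)
  ... | no _     | fz    = here refl
  ... | no _     | fs j′ = there (∈-map⁺ fs (∈-support⁺ (v ∘ fs) vj≢0))

  support-nonempty : ∀ {n} (v : Word F n) → NonZero F v → ∃₂ λ j₀ rest → support v ≡ j₀ ∷ rest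
  support-nonempty v (j , vj≢0) with support v | ∈-support⁺ v vj≢0
  ... | j₀ ∷ rest | _ = j₀ , rest , refl

  infixr 5 _∷ᶜ_
  _∷ᶜ_ : ∀ {t N} → Word F t → Matrix F t N → Matrix F t (suc N)
  (c ∷ᶜ M) i = c i ∷ᵥ M i

  wt-∷ᶜ : ∀ {t N} (c : Word F t) (M : Matrix F t N) y →
          wt F (encode F (c ∷ᶜ M) y) ≡ wt₁ (dot c y) + wt F (encode F M y)
  wt-∷ᶜ c M y = wt-step (encode F (c ∷ᶜ M) y)

  record ZeroColumnsDeleted {t N} (M : Matrix F t N) : Set where
    field
      {N′}          : ℕ
      M′            : Matrix F t N′
      nonDegenerate : NonDegenerate F M′
      wt-encode     : ∀ y → wt F (encode F M′ y) ≡ wt F (encode F M y)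
      N′+wt≤N       : ∀ v → (∀ j → v j ≢ 0F → ∀ i → M i j ≡ 0F) → N′ + wt F v ≤ N

  keepFirstColumn : ∀ {t N} (M : Matrix F t (suc N)) → (∃ λ i → M i fz ≢ 0F) →
                    ZeroColumnsDeleted (λ i j → M i (fs j)) → ZeroColumnsDeleted M
  keepFirstColumn {N = N} M (i₀ , Mi₀≢0) D = record
    { M′            = (λ i → M i fz) ∷ᶜ D.M′
    ; nonDegenerate = λ { fz → i₀ , Mi₀≢0 ; (fs j) → D.nonDegenerate j }
    ; wt-encode     = λ y → trans (wt-∷ᶜ (λ i → M i fz) D.M′ y)
                                  (trans (cong (wt₁ (encode F M y fz) +_) (D.wt-encode y))
                                         (sym (wt-step (encode F M y))))
    ; N′+wt≤N       = N′+wt≤N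
    }
    where
    module D = ZeroColumnsDeleted D
    N′+wt≤N : ∀ v → (∀ j → v j ≢ 0F → ∀ i → M i j ≡ 0F) → suc D.N′ + wt F v ≤ suc N
    N′+wt≤N v zero-columns with v fz ≟ 0F
    ... | yes _    = s≤s (D.N′+wt≤N (v ∘ fs) (zero-columns ∘ fs))
    ... | no v₀≢0 = contradiction (zero-columns fz v₀≢0 i₀) Mi₀≢0

  dropFirstColumn : ∀ {t N} (M : Matrix F t (suc N)) → (∀ i → M i fz ≡ 0F) →
                    ZeroColumnsDeleted (λ i j → M i (fs j)) → ZeroColumnsDeleted M
  dropFirstColumn {N = N} M M₀≡0 D = record
    { M′            = D.M′
    ; nonDegenerate = D.nonDegenerate
    ; wt-encode     = λ y → trans (D.wt-encode y)
                                  (sym (trans (wt-step (encode F M y))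
                                              (cong (_+ wt F (encode F M⁺ y)) (wt₁-zero (yM₀≡0 y)))))
    ; N′+wt≤N       = N′+wt≤N
    }
    where
    module D = ZeroColumnsDeleted D
    M⁺ : Matrix F _ N
    M⁺ i j = M i (fs j)
    yM₀≡0 : ∀ y → encode F M y fz ≡ 0F
    yM₀≡0 y = ΣF-zero (λ i → trans (cong (y i *F_) (M₀≡0 i)) (zeroʳ (y i)))
    N′+wt≤N : ∀ v → (∀ j → v j ≢ 0F → ∀ i → M i j ≡ 0F) → D.N′ + wt F v ≤ suc N
    N′+wt≤N v zero-columns = begin
      D.N′ + wt F v                               ≡⟨ cong (D.N′ +_) (wt-step v) ⟩
      D.N′ + (wt₁ (v fz) + wt F (v ∘ fs))         ≤⟨ ℕ.+-monoʳ-≤ D.N′ (ℕ.+-monoˡ-≤ _ (wt₁≤1 (v fz))) ⟩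
      D.N′ + suc (wt F (v ∘ fs))                  ≡⟨ ℕ.+-suc D.N′ _ ⟩
      suc (D.N′ + wt F (v ∘ fs))                  ≤⟨ s≤s (D.N′+wt≤N (v ∘ fs) (zero-columns ∘ fs)) ⟩
      suc N                                       ∎
      where open ℕ.≤-Reasoning

  deleteZeroColumns : ∀ {t N} (M : Matrix F t N) → ZeroColumnsDeleted M
  deleteZeroColumns {N = zero} M =
    record { M′ = M ; nonDegenerate = λ () ; wt-encode = λ _ → refl ; N′+wt≤N = λ _ _ → z≤n }
  deleteZeroColumns {t} {suc N} M with all? (λ i → M i fz ≟ 0F)
  ... | yes M₀≡0 = dropFirstColumn M M₀≡0 (deleteZeroColumns (λ i j → M i (fs j)))
  ... | no M₀≢0  =
    keepFirstColumn M (¬∀⟶∃¬ t _ (λ i → M i fz ≟ 0F) M₀≢0) (deleteZeroColumns (λ i j → M i (fs j)))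

  pad : ∀ {t N} (m : ℕ) → Word F t → Matrix F t N → Matrix F t (m + N)
  pad zero    c M = M
  pad (suc m) c M = c ∷ᶜ pad m c M

  RowsIndep-pad : ∀ {t N} m (c : Word F t) {M : Matrix F t N} → RowsIndep F M → RowsIndep F (pad m c M)
  RowsIndep-pad zero    c indep = indep
  RowsIndep-pad (suc m) c indep y yM≡0 = RowsIndep-pad m c indep y (yM≡0 ∘ fs)

  NonDegenerate-pad : ∀ {t N} m {c : Word F t} {M : Matrix F t N} →
                      NonZero F c → NonDegenerate F M → NonDegenerate F (pad m c M)
  NonDegenerate-pad zero    c≢0 nondeg = nondeg
  NonDegenerate-pad (suc m) c≢0 nondeg fz     = c≢0
  NonDegenerate-pad (suc m) c≢0 nondeg (fs j) = NonDegenerate-pad m c≢0 nondeg j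

  wt-pad-⊥ : ∀ {t N} m (c : Word F t) (M : Matrix F t N) {y} → dot c y ≡ 0F →
             wt F (encode F (pad m c M) y) ≡ wt F (encode F M y)
  wt-pad-⊥ zero    c M cy≡0 = refl
  wt-pad-⊥ (suc m) c M {y} cy≡0 =
    trans (wt-∷ᶜ c (pad m c M) y)
          (trans (cong (_+ wt F (encode F (pad m c M) y)) (wt₁-zero cy≡0)) (wt-pad-⊥ m c M cy≡0))

  WeightsAtLeast : ∀ {t N} → Matrix F t N → ℕ → Set
  WeightsAtLeast M d = ∀ y → NonZero F (encode F M y) → d ≤ wt F (encode F M y)

  WeightsAtLeast-∷ᶜ : ∀ {t N d} (c : Word F t) {M : Matrix F t N} → RowsIndep F M →
                      WeightsAtLeast M d → WeightsAtLeast (c ∷ᶜ M) d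
  WeightsAtLeast-∷ᶜ c {M} indep d≤ y cyM≢0 =
    ℕ.≤-trans (d≤ y (RowsIndep⇒NonZero-encode indep (NonZero-encode⇒NonZero (c ∷ᶜ M) y cyM≢0)))
              (ℕ.≤-trans (ℕ.m≤n+m _ (wt₁ (dot c y))) (ℕ.≤-reflexive (sym (wt-∷ᶜ c M y))))

  WeightsAtLeast-pad : ∀ {t N d} m (c : Word F t) {M : Matrix F t N} → RowsIndep F M →
                       WeightsAtLeast M d → WeightsAtLeast (pad m c M) d
  WeightsAtLeast-pad zero    c indep d≤ = d≤
  WeightsAtLeast-pad (suc m) c indep d≤ =
    WeightsAtLeast-∷ᶜ c (RowsIndep-pad m c indep) (WeightsAtLeast-pad m c indep d≤)

  MinDist⇒WeightsAtLeast : ∀ {t N d} {M : Matrix F t N} → MinDist F (InCode F M) d → WeightsAtLeast M d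
  MinDist⇒WeightsAtLeast {M = M} (_ , d≤) y yM≢0 = d≤ (encode F M y) (y , λ _ → refl) yM≢0

  WeightsAtLeast⇒≤MinDist : ∀ {t N d d′} {M : Matrix F t N} →
                            WeightsAtLeast M d → MinDist F (InCode F M) d′ → d ≤ d′
  WeightsAtLeast⇒≤MinDist d≤ ((v , (y , v≗yM) , v≢0 , wt≡d′) , _) =
    subst (_ ≤_) (trans (sym (wt-cong v≗yM)) wt≡d′) (d≤ y (NonZero-cong v≗yM v≢0))

  minimiser : ∀ t (f : Word F t → ℕ) → (∀ {y y′} → y ≗ y′ → f y ≡ f y′) → ∃ λ y* → ∀ y → f y* ≤ f y
  minimiser zero    f f-cong = (λ ()) , λ _ → ℕ.≤-reflexive (f-cong (λ ()))
  minimiser (suc t) f f-cong = a* ∷ᵥ best a* , λ y → begin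
      f (a* ∷ᵥ best a*)          ≤⟨ a*-min (y fz) ⟩
      f (y fz ∷ᵥ best (y fz))    ≤⟨ best-min (y fz) (y ∘ fs) ⟩
      f (y fz ∷ᵥ y ∘ fs)         ≡⟨ f-cong (λ { fz → refl ; (fs i) → refl }) ⟩
      f y                        ∎
    where
    open ℕ.≤-Reasoning
    bestTail : ∀ a → ∃ λ w → ∀ w′ → f (a ∷ᵥ w) ≤ f (a ∷ᵥ w′)
    bestTail a = minimiser t (λ w → f (a ∷ᵥ w)) (λ w≗w′ → f-cong (λ { fz → refl ; (fs i) → w≗w′ i }))
    best : Fin q → Word F t
    best a = proj₁ (bestTail a)
    best-min : ∀ a w′ → f (a ∷ᵥ best a) ≤ f (a ∷ᵥ w′)
    best-min a = proj₂ (bestTail a)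
    a* : Fin q
    a* = argmin (λ a → f (a ∷ᵥ best a)) 0F (allFin q)
    a*-min : ∀ a → f (a* ∷ᵥ best a*) ≤ f (a ∷ᵥ best a)
    a*-min a = All.lookup (f[argmin]≤f[xs] 0F (allFin q)) (∈-allFin a)

  MinDist-intro : ∀ {t N} {M : Matrix F t N} y* → NonZero F (encode F M y*) →
                  WeightsAtLeast M (wt F (encode F M y*)) → MinDist F (InCode F M) (wt F (encode F M y*))
  MinDist-intro {M = M} y* y*M≢0 d≤ =
    (encode F M y* , (y* , λ _ → refl) , y*M≢0 , refl) ,
    λ v (y , v≗yM) v≢0 → subst (_ ≤_) (sym (wt-cong v≗yM)) (d≤ y (NonZero-cong v≗yM v≢0))

  minDist-exists : ∀ {t N} (M : Matrix F t N) → (∃ λ y → NonZero F (encode F M y)) →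
                   ∃ (MinDist F (InCode F M))
  minDist-exists {t} {N} M (y₀ , y₀M≢0) = wt F (encode F M y*) , MinDist-intro y* y*M≢0 y*-minimal
    where
    open ℕ.≤-Reasoning
    penalised : Word F t → ℕ
    penalised y = nonzeroOr (suc N) (wt F (encode F M y))
    penalised-cong : ∀ {y y′} → y ≗ y′ → penalised y ≡ penalised y′
    penalised-cong y≗y′ = cong (nonzeroOr (suc N)) (wt-cong (encode-cong M y≗y′))
    penalised≡wt : ∀ {y} → NonZero F (encode F M y) → penalised y ≡ wt F (encode F M y)
    penalised≡wt yM≢0 = nonzeroOr-pos (suc N) (NonZero⇒wt>0 _ yM≢0)
    y* : Word F t
    y* = proj₁ (minimiser t penalised penalised-cong)
    y*-min : ∀ y → penalised y* ≤ penalised y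
    y*-min = proj₂ (minimiser t penalised penalised-cong)
    y*M≢0 : NonZero F (encode F M y*)
    y*M≢0 with zero⊎NonZero (encode F M y*)
    ... | inj₂ y*M≢0 = y*M≢0
    ... | inj₁ y*M≡0 = contradiction (begin
      suc N                   ≡⟨ cong (nonzeroOr (suc N)) (zero⇒wt≡0 _ y*M≡0) ⟨
      penalised y*            ≤⟨ y*-min y₀ ⟩
      penalised y₀            ≡⟨ penalised≡wt y₀M≢0 ⟩
      wt F (encode F M y₀)    ≤⟨ wt≤length (encode F M y₀) ⟩
      N                       ∎) (ℕ.n≮n N)
    y*-minimal : WeightsAtLeast M (wt F (encode F M y*))
    y*-minimal y yM≢0 = begin
      wt F (encode F M y*)    ≡⟨ penalised≡wt y*M≢0 ⟨
      penalised y*            ≤⟨ y*-min y ⟩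
      penalised y             ≡⟨ penalised≡wt yM≢0 ⟩
      wt F (encode F M y)     ∎

  mul : ∀ {t k n} → Matrix F t k → Matrix F k n → Matrix F t n
  mul X G a = encode F G (X a)

  encode-mul : ∀ {t k n} (X : Matrix F t k) (G : Matrix F k n) y →
               encode F (mul X G) y ≗ encode F G (encode F X y)
  encode-mul X G y j = sym ([xA]z≡x[Az] y X (λ c → G c j))

  RowsIndep-mul : ∀ {t k n} {X : Matrix F t k} {G : Matrix F k n} →
                  RowsIndep F X → RowsIndep F G → RowsIndep F (mul X G)
  RowsIndep-mul {X = X} {G} X-indep G-indep y yXG≡0 =
    X-indep y (G-indep (encode F X y) (λ j → trans (sym (encode-mul X G y j)) (yXG≡0 j)))

  WeightsAtLeast-mul : ∀ {t k n d} {X : Matrix F t k} {G : Matrix F k n} →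
                       WeightsAtLeast G d → WeightsAtLeast (mul X G) d
  WeightsAtLeast-mul {X = X} {G} d≤ y yXG≢0 =
    subst (_ ≤_) (sym (wt-cong (encode-mul X G y)))
          (d≤ (encode F X y) (NonZero-cong (encode-mul X G y) yXG≢0))

  RowsIndep-wt : ∀ {t N N′} {M : Matrix F t N} {M′ : Matrix F t N′} →
                 (∀ y → wt F (encode F M′ y) ≡ wt F (encode F M y)) → RowsIndep F M → RowsIndep F M′
  RowsIndep-wt wt≡ indep y yM′≡0 = indep y (wt≡0⇒zero _ (trans (sym (wt≡ y)) (zero⇒wt≡0 _ yM′≡0)))

  WeightsAtLeast-wt : ∀ {t N N′ d} {M : Matrix F t N} {M′ : Matrix F t N′} →
                      (∀ y → wt F (encode F M′ y) ≡ wt F (encode F M y)) →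
                      WeightsAtLeast M d → WeightsAtLeast M′ d
  WeightsAtLeast-wt wt≡ d≤ y yM′≢0 =
    subst (_ ≤_) (sym (wt≡ y)) (d≤ y (wt>0⇒NonZero _ (subst (0 <_) (wt≡ y) (NonZero⇒wt>0 _ yM′≢0))))

  encode⊥dual : ∀ {k n} {G : Matrix F k n} {v} → InDual F G v →
                ∀ x → ΣF F (λ j → encode F G x j *F v j) ≡ 0F
  encode⊥dual {G = G} {v} v⊥G x =
    trans ([xA]z≡x[Az] x G v) (ΣF-zero (λ i → trans (cong (x i *F_) (v⊥G i)) (zeroʳ (x i))))

  zero-on-support : ∀ {k n} {G : Matrix F k n} {v} → InDual F G v →
                    ∀ {j₀ rest} → support v ≡ j₀ ∷ rest →
                    ∀ x → (∀ {j} → j ∈ rest → encode F G x j ≡ 0F) →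
                    ∀ j → v j ≢ 0F → encode F G x j ≡ 0F
  zero-on-support {G = G} {v} v⊥G {j₀} {rest} supp≡ x zero-on-rest j vj≢0
    with subst (j ∈_) supp≡ (∈-support⁺ v vj≢0)
  ... | there j∈rest = zero-on-rest j∈rest
  ... | here refl    = x*y≡0⇒x≡0 vj≢0 (trans (sym (ΣF-single (λ i → encode F G x i *F v i) j₀ off-j₀))
                                             (encode⊥dual {G = G} v⊥G x))
    where
    off-j₀ : ∀ i → i ≢ j₀ → encode F G x i *F v i ≡ 0F
    off-j₀ i i≢j₀ with v i ≟ 0F
    ... | yes vi≡0 = trans (cong (_ *F_) vi≡0) (zeroʳ _)
    ... | no vi≢0 with subst (i ∈_) supp≡ (∈-support⁺ v vi≢0)
    ...   | here i≡j₀    = contradiction i≡j₀ i≢j₀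
    ...   | there i∈rest = trans (cong (_*F v i) (zero-on-rest i∈rest)) (zeroˡ (v i))

  record CodeWithDistance≥ (t d : ℕ) : Set where
    field
      {N}           : ℕ
      generator     : Matrix F t N
      independent   : RowsIndep F generator
      nonDegenerate : NonDegenerate F generator
      distance≥     : WeightsAtLeast generator d

  shorten : ∀ {k n t d} (G : Matrix F k n) → RowsIndep F G → WeightsAtLeast G d →
            ∀ {v} → InDual F G v → NonZero F v → wt F v + t ≤ suc k →
            Σ (CodeWithDistance≥ t d) λ C → CodeWithDistance≥.N C + wt F v ≤ n
  shorten {k} {n} {t} {d} G G-indep G-dist {v} v⊥G v≢0 wt+t≤1+k with support-nonempty v v≢0
  ... | j₀ , rest , supp≡ with echelonSolutions (map (λ j i → G i j) rest) t |rest|+t≤k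
    where
    |rest|+t≤k : length (map (λ j i → G i j) rest) + t ≤ k
    |rest|+t≤k = ℕ.≤-pred (subst (_≤ suc k) (cong (_+ t) (sym 1+|rest|≡wt)) wt+t≤1+k)
      where
      1+|rest|≡wt : suc (length (map (λ j i → G i j) rest)) ≡ wt F v
      1+|rest|≡wt = trans (cong suc (length-map (λ j i → G i j) rest))
                          (trans (cong length (sym supp≡)) (length-support v))
  ...   | X , P , echelon , X-solves = code , D.N′+wt≤N v zero-columns
    where
    M : Matrix F t n
    M = mul X G
    module D = ZeroColumnsDeleted (deleteZeroColumns M)
    zero-columns : ∀ j → v j ≢ 0F → ∀ a → M a j ≡ 0F
    zero-columns j vj≢0 a = zero-on-support v⊥G supp≡ (X a) (All.lookup (map⁻ (X-solves a))) j vj≢0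
    code : CodeWithDistance≥ t d
    code = record
      { generator     = D.M′
      ; independent   = RowsIndep-wt D.wt-encode (RowsIndep-mul (echelon⇒RowsIndep echelon) G-indep)
      ; nonDegenerate = D.nonDegenerate
      ; distance≥     = WeightsAtLeast-wt D.wt-encode (WeightsAtLeast-mul G-dist)
      }

  lengthen : ∀ {t d} (C : CodeWithDistance≥ (suc (suc t)) d) → let open CodeWithDistance≥ C in
             ∀ s m₀ → m₀ + N + 1 ≤ suc (suc t) + d + s →
             ∃ λ m → m₀ ≤ m × IsAsMDS F (pad m (unit fz) generator) s
  lengthen {t} {d} C s m₀ initially = m , m₀≤m ,
    RowsIndep-pad m e₀ {generator} independent ,
    NonDegenerate-pad m {M = generator} (unit-nonzero fz) nonDegenerate ,
    distance m , minDist m , eq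
    where
    open CodeWithDistance≥ C
    open ℕ.≤-Reasoning
    e₀ e₁ : Word F (suc (suc t))
    e₀ = unit fz
    e₁ = unit (fs fz)
    wt-e₁ : ∀ m → wt F (encode F (pad m e₀ generator) e₁) ≡ wt F (encode F generator e₁)
    wt-e₁ m = wt-pad-⊥ m e₀ generator {e₁}
                (trans (dot-unit fz e₁) (unit-off {suc (suc t)} {fs fz} {fz} λ ()))
    e₁-nonzero : ∀ m → NonZero F (encode F (pad m e₀ generator) e₁)
    e₁-nonzero m = wt>0⇒NonZero _ (subst (0 <_) (sym (wt-e₁ m)) (NonZero⇒wt>0 _ e₁G≢0))
      where
      e₁G≢0 : NonZero F (encode F generator e₁)
      e₁G≢0 = RowsIndep⇒NonZero-encode {M = generator} independent {e₁} (unit-nonzero (fs fz))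
    distance : ℕ → ℕ
    distance m = proj₁ (minDist-exists (pad m e₀ generator) (e₁ , e₁-nonzero m))
    minDist : ∀ m → MinDist F (InCode F (pad m e₀ generator)) (distance m)
    minDist m = proj₂ (minDist-exists (pad m e₀ generator) (e₁ , e₁-nonzero m))
    distance-mono : ∀ m → distance m ≤ distance (suc m)
    distance-mono m = WeightsAtLeast⇒≤MinDist {M = pad (suc m) e₀ generator}
      (WeightsAtLeast-∷ᶜ e₀ {pad m e₀ generator} (RowsIndep-pad m e₀ {generator} independent)
        (MinDist⇒WeightsAtLeast {M = pad m e₀ generator} (minDist m)))
      (minDist (suc m))
    distance≤N : ∀ m → distance m ≤ N
    distance≤N m = begin
      distance m
        ≤⟨ MinDist⇒WeightsAtLeast {M = pad m e₀ generator} (minDist m) e₁ (e₁-nonzero m) ⟩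
      wt F (encode F (pad m e₀ generator) e₁)  ≡⟨ wt-e₁ m ⟩
      wt F (encode F generator e₁)             ≤⟨ wt≤length (encode F generator e₁) ⟩
      N                                        ∎
    d≤distance : ∀ m → d ≤ distance m
    d≤distance m = WeightsAtLeast⇒≤MinDist {M = pad m e₀ generator}
                     (WeightsAtLeast-pad m e₀ {generator} independent distance≥) (minDist m)
    caught : ∃ λ m → m₀ ≤ m × m + N + 1 ≡ suc (suc t) + distance m + s
    caught = catchUp (λ m → m + N + 1) (λ m → suc (suc t) + distance m + s) (λ _ → refl)
      (λ m → target-mono (distance-mono m)) (λ m → target-mono (distance≤N m))
      m₀ (ℕ.≤-trans initially (target-mono (d≤distance m₀)))
      where
      target-mono : ∀ {a b} → a ≤ b → suc (suc t) + a + s ≤ suc (suc t) + b + s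
      target-mono a≤b = ℕ.+-monoˡ-≤ s (ℕ.+-monoʳ-≤ (suc (suc t)) a≤b)
    m : ℕ
    m = proj₁ caught
    m₀≤m : m₀ ≤ m
    m₀≤m = proj₁ (proj₂ caught)
    eq : m + N + 1 ≡ suc (suc t) + distance m + s
    eq = proj₂ (proj₂ caught)

x+1≡y+s⇒x≤y+[s∸1] : ∀ x y s → x + 1 ≡ y + s → x ≤ y + (s ∸ 1)
x+1≡y+s⇒x≤y+[s∸1] x y zero    x+1≡y+0 = ℕ.≤-trans (ℕ.m≤m+n x 1) (ℕ.≤-reflexive x+1≡y+0)
x+1≡y+s⇒x≤y+[s∸1] x y (suc s) x+1≡y+1+s =
  ℕ.≤-reflexive (ℕ.suc-injective (trans (trans (ℕ.+-comm 1 x) x+1≡y+1+s) (ℕ.+-suc y s)))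

defect-budget : ∀ {m₀ N w n k t d s} → m₀ + (N + w) ≡ n → n + 1 ≡ k + d + s → k + 1 ≡ w + t →
                m₀ + N + 1 ≤ t + d + (s ∸ 1)
defect-budget {m₀} {N} {w} {n} {k} {t} {d} {s} m₀+N+w≡n n+1≡k+d+s k+1≡w+t =
  x+1≡y+s⇒x≤y+[s∸1] (m₀ + N + 1) (t + d) s (ℕ.+-cancelʳ-≡ w _ _ (begin
    m₀ + N + 1 + 1 + w       ≡⟨ solve (m₀ ∷ N ∷ w ∷ []) ⟩
    m₀ + (N + w) + 1 + 1     ≡⟨ cong (λ x → x + 1 + 1) m₀+N+w≡n ⟩
    n + 1 + 1                ≡⟨ cong (_+ 1) n+1≡k+d+s ⟩
    k + d + s + 1            ≡⟨ solve (k ∷ d ∷ s ∷ []) ⟩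
    k + 1 + d + s            ≡⟨ cong (λ x → x + d + s) k+1≡w+t ⟩
    w + t + d + s            ≡⟨ solve (w ∷ t ∷ d ∷ s ∷ []) ⟩
    t + d + s + w            ∎))
  where open ≡-Reasoning

length-budget : ∀ {m₀ m N w n k t} → m₀ + (N + w) ≡ n → k + 1 ≡ w + t → m₀ ≤ m → n + t ≤ m + N + k + 1
length-budget {m₀} {m} {N} {w} {n} {k} {t} m₀+N+w≡n k+1≡w+t m₀≤m = begin
  n + t                   ≡⟨ cong (_+ t) m₀+N+w≡n ⟨
  m₀ + (N + w) + t        ≡⟨ solve (m₀ ∷ N ∷ w ∷ t ∷ []) ⟩
  m₀ + N + (w + t)        ≡⟨ cong (m₀ + N +_) k+1≡w+t ⟨
  m₀ + N + (k + 1)        ≡⟨ solve (m₀ ∷ N ∷ k ∷ []) ⟩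
  m₀ + N + k + 1          ≤⟨ ℕ.+-monoˡ-≤ 1 (ℕ.+-monoˡ-≤ k (ℕ.+-monoˡ-≤ N m₀≤m)) ⟩
  m + N + k + 1           ∎
  where open ℕ.≤-Reasoning

mainTheorem5 : (q : ℕ) (F : FiniteField q) (k t s n : ℕ) (G : Matrix F k n) →
    3 ≤ k → 1 < t →
    IsAsMDS F G s → DualIsAtMDS F G t →
    Σ ℕ λ n′ → Σ (Matrix F t n′) λ G′ →
    IsAsMDS F G′ (s ∸ 1) × n + t ≤ n′ + k + 1
mainTheorem5 q F k zero          s n G _ ()        _ _
mainTheorem5 q F k (suc zero)    s n G _ (s≤s ())  _ _
mainTheorem5 q F k t@(suc (suc _)) s n G _ _
             (G-indep , _ , d , G-dist , n+1≡k+d+s) (d⊥ , ((v , v⊥G , v≢0 , wt≡d⊥) , _) , k+1≡d⊥+t) =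
  m + N , pad F m (unit F fz) generator , proj₂ (proj₂ lengthened) ,
  length-budget {N = N} {w = wt F v} {t = t} m₀+N+w≡n k+1≡w+t (proj₁ (proj₂ lengthened))
  where
  k+1≡w+t : k + 1 ≡ wt F v + t
  k+1≡w+t = trans k+1≡d⊥+t (cong (_+ t) (sym wt≡d⊥))
  shortened : Σ (CodeWithDistance≥ F t d) λ C → CodeWithDistance≥.N C + wt F v ≤ n
  shortened = shorten F G G-indep (MinDist⇒WeightsAtLeast F {M = G} G-dist) {v} v⊥G v≢0
                (ℕ.≤-reflexive (sym (trans (ℕ.+-comm 1 k) k+1≡w+t)))
  open CodeWithDistance≥ (proj₁ shortened)
  m₀ : ℕ
  m₀ = n ∸ (N + wt F v)
  m₀+N+w≡n : m₀ + (N + wt F v) ≡ n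
  m₀+N+w≡n = ℕ.m∸n+n≡m (proj₂ shortened)
  lengthened : ∃ λ m → m₀ ≤ m × IsAsMDS F (pad F m (unit F fz) generator) (s ∸ 1)
  lengthened = lengthen F (proj₁ shortened) (s ∸ 1) m₀
                 (defect-budget {N = N} {w = wt F v} {t = t} {d} {s} m₀+N+w≡n n+1≡k+d+s k+1≡w+t)
  m : ℕ
  m = proj₁ lengthened
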